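{- Let $G=(A,B;E)$ be a bipartite graph with girth at least $2g$, let $k$ be a positive integer, and let $H$ be a bipartite graph with vertex classes $A$ and $[k]$. Suppose that $H$ contains no cycle $u_1,\ell_1,\dots,u_h,\ell_h$ with $u_1,\dots,u_h\in A$, $\ell_1,\dots,\ell_h\in[k]$, for some $h<g$, such that $u_1,\dots,u_h$ have a common neighbor in $G$. Then $G\otimes_H k$ has girth at least $2g$.
   Context: For a bipartite graph $G=(A,B;E)$ and a positive integer $k$, the bipartite graph $G\otimes k$ has vertex classes $A\times[k]$ and $(B\times[k])\cup A'$, where $A'$ is a disjoint copy of $A$; $(u,i)\in A\times[k]$ and $(v,j)\in B\times[k]$ are adjacent iff $i=j$ and $\{u,v\}\in E$; and $(u,i)\in A\times[k]$ and $v\in A'$ are adjacent iff $v$ is the copy of $u$. For a bipartite graph $H$ with vertex classes $A$ and $[k]$, $G\otimes_H k$ is the induced subgraph of $G\otimes k$ obtained by keeping, of the vertices in $A\times[k]$, only those $(u,i)$ with $\{u,i\}\in E(H)$ (all vertices of $(B\times[k])\cup A'$ are kept). The girth of a graph is the length of its shortest cycle. -}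

module Defs where

open import Data.Nat using (ℕ; zero; suc; _≤_; _<_)
open import Data.Fin using (Fin; zero; suc; inject₁; fromℕ)
open import Data.Bool using (Bool; true)
open import Data.Product using (Σ; _×_; _,_; ∃)
open import Data.Sum using (_⊎_; inj₁; inj₂)
open import Function.Definitions using (Injective)
open import Relation.Binary.PropositionalEquality using (_≡_)
open import Relation.Nullary using (¬_)

-- A cycle of length 2(m+1) in a bipartite graph with classes X, Y and
-- adjacency relation adj : X → Y → Set:
--   u 0, v 0, u 1, v 1, ..., u m, v m   (and back to u 0),
-- all u's distinct, all v's distinct.
record Cycle {X Y : Set} (adj : X → Y → Set) (m : ℕ) : Set where
  field
    u     : Fin (suc m) → X
    v     : Fin (suc m) → Y
    u-inj : Injective _≡_ _≡_ u
    v-inj : Injective _≡_ _≡_ v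
    spoke : ∀ i → adj (u i) (v i)
    step  : ∀ (i : Fin m) → adj (u (suc i)) (v (inject₁ i))
    close : adj (u zero) (v (fromℕ m))

-- A genuine cycle has h = m+1 ≥ 2 vertices on each side (length 2h ≥ 4).
-- Girth at least 2g: no cycle of length 2h with 2 ≤ h < g.
GirthAtLeast2 : {X Y : Set} → (X → Y → Set) → ℕ → Set
GirthAtLeast2 adj g = ∀ m → 1 ≤ m → suc m < g → ¬ Cycle adj m

HAdj : {A : Set} {k : ℕ} → (A → Fin k → Bool) → A → Fin k → Set
HAdj H u l = H u l ≡ true

TensorL : (A : Set) (k : ℕ) → (A → Fin k → Bool) → Set
TensorL A k H = Σ (A × Fin k) (λ { (u , i) → H u i ≡ true })

TensorR : (A B : Set) (k : ℕ) → Set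
TensorR A B k = (B × Fin k) ⊎ A    -- inj₁ (v , j) ∈ B × [k],  inj₂ a = copy of a in A'

TensorAdj : {A B : Set} (E : A → B → Set) (k : ℕ) (H : A → Fin k → Bool) →
            TensorL A k H → TensorR A B k → Set
TensorAdj E k H ((u , i) , _) (inj₁ (v , j)) = (i ≡ j) × E u v
TensorAdj E k H ((u , i) , _) (inj₂ a)       = a ≡ u

CommonNeighbour : {A B : Set} → (A → B → Set) → {m : ℕ} → (Fin (suc m) → A) → Set
CommonNeighbour {B = B} E u = ∃ λ (b : B) → ∀ i → E (u i) b

-- Follow a short cycle of G ⊗_H k and forget the layers of its left vertices. A passage (a , i), a′, (a , i′)
-- through the copy a′ ∈ A′ of a ∈ A then stutters at a; splicing the stutters out leaves a closed walk
-- through distinct vertices of B × [k] that never returns immediately, in the graph on A and B × [k]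
-- joining u to (v , j) when u ~ v in G and u ~ j in H. Its first repeated vertex closes a short cycle
-- there. Projected to G, that cycle is a closed walk of length < 2g through distinct vertices of A, so by
-- the girth of G all its B-coordinates are one vertex b; its layers then form a cycle of H, of length
-- < 2g, whose vertices in A have the common neighbour b, which the hypothesis forbids.

module Submission where

open import Defs

open import Data.Nat using (ℕ; zero; suc; pred; _+_; _≤_; _<_; z≤n; s≤s)
open import Data.Nat.Properties
  using (≤-refl; ≤-reflexive; ≤-trans; <-trans; ≤-<-trans; <⇒≤; ≤-pred; <-cmp; n<1+n; m≤n⇒m≤1+n;
         m<n⇒m<1+n; m<1+n⇒m<n∨m≡n; m≤n⇒m<n∨m≡n; m≤n⇒∃[o]m+o≡n; +-suc; +-identityʳ;
         +-cancelˡ-≡; +-monoʳ-<; +-monoʳ-≤; m≤m+n; m≤n+m; m≢1+m+n)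
open import Data.Fin using (Fin; toℕ; inject₁; fromℕ; fromℕ<)
import Data.Fin as Fin
open import Data.Fin.Properties
  using (toℕ-injective; toℕ<n; toℕ≤pred[n]; toℕ-fromℕ<; toℕ-inject₁; toℕ-fromℕ)
open import Data.Nat.DivMod using (_mod_; n%n≡0; m<n⇒m%n≡m)
open import Data.Bool using (Bool)
import Data.Bool as Bool
open import Axiom.UniquenessOfIdentityProofs using (module Decidable⇒UIP)
open import Data.Product using (∃; ∃-syntax; _×_; _,_; proj₁; proj₂; map)
open import Data.Product.Properties using (×-≡,≡→≡)
open import Data.Sum using (_⊎_; inj₁; inj₂; fromInj₁)
open import Data.Empty using (⊥; ⊥-elim)
open import Data.Unit using (⊤; tt)
open import Function using (_∘_)
open import Relation.Nullary using (¬_; yes; no; contradiction)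
open import Relation.Nullary.Decidable using (¬¬-excluded-middle)
open import Relation.Binary.Definitions using (tri<; tri≈; tri>)
open import Relation.Binary.PropositionalEquality using (_≡_; _≢_; refl; sym; trans; cong; subst; subst₂)

private variable
  X Y : Set
  m n t : ℕ

InjectiveBelow : (ℕ → X) → ℕ → Set
InjectiveBelow f n = ∀ {i j} → i < n → j < n → f i ≡ f j → i ≡ j

InjectiveBelow-shift : ∀ {f : ℕ → X} a → a + m ≤ n → InjectiveBelow f n →
                       InjectiveBelow (λ t → f (a + t)) m
InjectiveBelow-shift {m = m} {n = n} a a+m≤n inj t<m t′<m eq =
  +-cancelˡ-≡ a _ _ (inj (bound t<m) (bound t′<m) eq)
  where
  bound : ∀ {t} → t < m → a + t < n
  bound t<m = ≤-trans (+-monoʳ-< a t<m) a+m≤n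

record FirstRepeat (f : ℕ → X) (n : ℕ) : Set where
  field
    i gap           : ℕ
    bound           : suc (i + gap) < n
    repeat          : f i ≡ f (suc (i + gap))
    injectiveBefore : InjectiveBelow f (suc (i + gap))

injective-or-firstRepeat : (f : ℕ → X) (n : ℕ) → ¬ ¬ (InjectiveBelow f n ⊎ FirstRepeat f n)
injective-or-firstRepeat f zero k = k (inj₁ λ ())
injective-or-firstRepeat f (suc n) k = injective-or-firstRepeat f n λ where
    (inj₂ r) → k (inj₂ (weaken r))
    (inj₁ inj) → ¬¬-excluded-middle {A = ∃ λ i → i < n × f i ≡ f n} λ where
      (yes (i , i<n , fi≡fn)) → k (inj₂ (repeatAt i<n fi≡fn inj))
      (no noRepeat) → k (inj₁ (extend inj noRepeat))
  where
  weaken : FirstRepeat f n → FirstRepeat f (suc n)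
  weaken r = record { FirstRepeat r ; bound = m<n⇒m<1+n (FirstRepeat.bound r) }
  repeatAt : ∀ {i} → i < n → f i ≡ f n → InjectiveBelow f n → FirstRepeat f (suc n)
  repeatAt {i} i<n fi≡fn inj with m≤n⇒∃[o]m+o≡n i<n
  ... | gap , refl = record { i = i ; gap = gap ; bound = ≤-refl ; repeat = fi≡fn ; injectiveBefore = inj }
  extend : InjectiveBelow f n → ¬ (∃ λ i → i < n × f i ≡ f n) → InjectiveBelow f (suc n)
  extend inj noRepeat i<1+n j<1+n eq with m<1+n⇒m<n∨m≡n i<1+n | m<1+n⇒m<n∨m≡n j<1+n
  ... | inj₁ i<n  | inj₁ j<n  = inj i<n j<n eq
  ... | inj₁ i<n  | inj₂ refl = contradiction (_ , i<n , eq) noRepeat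
  ... | inj₂ refl | inj₁ j<n  = contradiction (_ , j<n , sym eq) noRepeat
  ... | inj₂ refl | inj₂ refl = refl

-- The ℕ analogue of Data.Fin.punchIn: skip j enumerates ℕ ∖ {j} in increasing order.
skip : ℕ → ℕ → ℕ
skip zero    t       = suc t
skip (suc j) zero    = zero
skip (suc j) (suc t) = suc (skip j t)

skip-< : ∀ {j t} → t < j → skip j t ≡ t
skip-< {suc j} {zero}  _         = refl
skip-< {suc j} {suc t} (s≤s t<j) = cong suc (skip-< t<j)

skip-≥ : ∀ {j t} → j ≤ t → skip j t ≡ suc t
skip-≥ {zero}          _         = refl
skip-≥ {suc j} {suc t} (s≤s j≤t) = cong suc (skip-≥ j≤t)

skip-≤ : ∀ j t → skip j t ≤ suc t
skip-≤ zero    t       = ≤-refl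
skip-≤ (suc j) zero    = z≤n
skip-≤ (suc j) (suc t) = s≤s (skip-≤ j t)

skip-injective : ∀ j {t t′} → skip j t ≡ skip j t′ → t ≡ t′
skip-injective zero    refl = refl
skip-injective (suc j) {zero}  {zero}   _  = refl
skip-injective (suc j) {suc t} {suc t′} eq = cong suc (skip-injective j (cong pred eq))

InjectiveBelow-skip : ∀ {f : ℕ → X} j → InjectiveBelow f (suc n) → InjectiveBelow (f ∘ skip j) n
InjectiveBelow-skip {n = n} j inj t<n t′<n eq = skip-injective j (inj (bound t<n) (bound t′<n) eq)
  where
  bound : ∀ {t} → t < n → skip j t < suc n
  bound {t} t<n = s≤s (≤-trans (skip-≤ j t) t<n)

skip-cover : ∀ {f : ℕ → X} {i c} → i ≤ n → f i ≡ f (suc i) →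
             (∀ t → t ≤ n → f (skip i t) ≡ c) → ∀ t → t ≤ suc n → f t ≡ c
skip-cover {n = n} {f = f} {i = i} i≤n fi≡fi+1 const t t≤1+n with <-cmp t i
... | tri< t<i _ _ = trans (cong f (sym (skip-< t<i))) (const t (≤-trans (<⇒≤ t<i) i≤n))
... | tri≈ _ refl _ = trans fi≡fi+1 (trans (cong f (sym (skip-≥ ≤-refl))) (const t i≤n))
skip-cover {n = n} {f = f} i≤n _ const (suc t) (s≤s t≤n) | tri> _ _ (s≤s i≤t) =
  trans (cong f (sym (skip-≥ i≤t))) (const t t≤n)

-- The closed walk x 0, y 0, x 1, …, x n, y n, x (suc n) = x 0; both sequences are junk past these indices.
record ClosedWalk (Step : X → Y → X → Set) (n : ℕ) : Set where
  field
    x      : ℕ → X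
    y      : ℕ → Y
    step   : ∀ t → t ≤ n → Step (x t) (y t) (x (suc t))
    closed : x (suc n) ≡ x 0

open ClosedWalk

module _ {Step : X → Y → X → Set} where

  mapWalk : ∀ {X′ Y′ : Set} {Step′ : X′ → Y′ → X′ → Set} (f : X → X′) (h : Y → Y′)
            (w : ClosedWalk Step n) →
            (∀ t → t ≤ n → Step′ (f (x w t)) (h (y w t)) (f (x w (suc t)))) → ClosedWalk Step′ n
  mapWalk f h w step′ = record { x = f ∘ x w ; y = h ∘ y w ; step = step′ ; closed = cong f (closed w) }

  -- Removes y t and x (suc t), joining x t to x (suc (suc t)) through y (suc t).
  splice : (w : ClosedWalk Step (suc n)) → t ≤ n →
           Step (x w t) (y w (suc t)) (x w (suc (suc t))) → ClosedWalk Step n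
  splice {n} {t} w t≤n junction = record
    { x      = x w ∘ skip (suc t)
    ; y      = y w ∘ skip t
    ; step   = step′
    ; closed = trans (cong (x w) (skip-≥ (s≤s t≤n))) (closed w)
    }
    where
    step′ : ∀ s → s ≤ n → Step (x w (skip (suc t) s)) (y w (skip t s)) (x w (skip (suc t) (suc s)))
    step′ s s≤n with <-cmp s t
    ... | tri< s<t _ _ rewrite skip-< (m<n⇒m<1+n s<t) | skip-< s<t =
      step w s (m≤n⇒m≤1+n s≤n)
    ... | tri≈ _ refl _ rewrite skip-< (≤-refl {suc s}) | skip-≥ (≤-refl {s}) =
      junction
    ... | tri> _ _ t<s rewrite skip-≥ t<s | skip-≥ (<⇒≤ t<s) =
      step w (suc s) (s≤s s≤n)

  dropLast : (w : ClosedWalk Step (suc n)) → x w (suc n) ≡ x w 0 → ClosedWalk Step n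
  dropLast w closed′ = record
    { x = x w ; y = y w ; step = λ t t≤n → step w t (m≤n⇒m≤1+n t≤n) ; closed = closed′ }

  adjacent-distinct : (w : ClosedWalk Step (suc n)) → InjectiveBelow (x w) (suc (suc n)) →
                      ∀ t → t ≤ suc n → x w t ≢ x w (suc t)
  adjacent-distinct w inj t t≤1+n eq with m≤n⇒m<n∨m≡n t≤1+n
  ... | inj₁ t<1+n = contradiction (inj (s≤s (<⇒≤ t<1+n)) (s≤s t<1+n) eq) λ ()
  ... | inj₂ refl  = contradiction (inj (s≤s ≤-refl) (s≤s z≤n) (trans eq (closed w))) λ ()

Wedge : (X → Y → Set) → X → Y → X → Set
Wedge adj u v u′ = adj u v × adj u′ v

ProperWedge : (X → Y → Set) → X → Y → X → Set
ProperWedge adj u v u′ = Wedge adj u v u′ × u ≢ u′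

toℕ-mod : ∀ {m t} → t ≤ m → toℕ (t mod suc m) ≡ t
toℕ-mod t≤m = trans (toℕ-fromℕ< _) (m<n⇒m%n≡m (s≤s t≤m))

mod-≡ : ∀ {m t} (i : Fin (suc m)) → toℕ i ≡ t → t mod suc m ≡ i
mod-≡ i refl = toℕ-injective (toℕ-mod (toℕ≤pred[n] i))

mod-self : ∀ m → suc m mod suc m ≡ 0 mod suc m
mod-self m = toℕ-injective (trans (toℕ-fromℕ< _) (trans (n%n≡0 (suc m)) (sym (toℕ-mod {m} z≤n))))

mod-injective : ∀ {m t t′} → t < suc m → t′ < suc m → t mod suc m ≡ t′ mod suc m → t ≡ t′
mod-injective t<1+m t′<1+m eq =
  trans (sym (toℕ-mod (≤-pred t<1+m))) (trans (cong toℕ eq) (toℕ-mod (≤-pred t′<1+m)))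

module _ {adj : X → Y → Set} where

  cycleWalk : Cycle adj m → ClosedWalk (Wedge adj) m
  cycleWalk {m} c = record
    { x      = λ t → u (t mod suc m)
    ; y      = λ t → v (t mod suc m)
    ; step   = λ t t≤m → spoke _ , next t t≤m
    ; closed = cong u (mod-self m)
    }
    where
    open Cycle c using (u; v; spoke; close)
    next : ∀ t → t ≤ m → adj (u (suc t mod suc m)) (v (t mod suc m))
    next t t≤m with m≤n⇒m<n∨m≡n t≤m
    ... | inj₁ t<m = subst₂ (λ a b → adj (u a) (v b))
      (sym (mod-≡ (Fin.suc i) (cong suc (toℕ-fromℕ< t<m))))
      (sym (mod-≡ (inject₁ i) (trans (toℕ-inject₁ i) (toℕ-fromℕ< t<m))))
      (Cycle.step c i)
      where i = fromℕ< t<m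
    ... | inj₂ refl = subst₂ (λ a b → adj (u a) (v b))
      (sym (trans (mod-self m) (mod-≡ Fin.zero refl)))
      (sym (mod-≡ (fromℕ m) (toℕ-fromℕ m)))
      close

  cycleWalk-injectiveˣ : (c : Cycle adj m) → InjectiveBelow (x (cycleWalk c)) (suc m)
  cycleWalk-injectiveˣ c t<1+m t′<1+m eq = mod-injective t<1+m t′<1+m (Cycle.u-inj c eq)

  cycleWalk-injectiveʸ : (c : Cycle adj m) → InjectiveBelow (y (cycleWalk c)) (suc m)
  cycleWalk-injectiveʸ c t<1+m t′<1+m eq = mod-injective t<1+m t′<1+m (Cycle.v-inj c eq)

  segmentCycle : (w : ClosedWalk (Wedge adj) n) (a : ℕ) → a + m ≤ n →
                 InjectiveBelow (λ t → x w (a + t)) (suc m) → InjectiveBelow (λ t → y w (a + t)) (suc m) →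
                 adj (x w a) (y w (a + m)) → Cycle adj m
  segmentCycle {m = m} w a a+m≤n injˣ injʸ close = record
    { u     = λ i → x w (a + toℕ i)
    ; v     = λ i → y w (a + toℕ i)
    ; u-inj = λ eq → toℕ-injective (injˣ (toℕ<n _) (toℕ<n _) eq)
    ; v-inj = λ eq → toℕ-injective (injʸ (toℕ<n _) (toℕ<n _) eq)
    ; spoke = λ i → proj₁ (wedge (toℕ i) (toℕ≤pred[n] i))
    ; step  = λ i → subst₂ (λ s s′ → adj (x w s) (y w (a + s′)))
                      (sym (+-suc a (toℕ i))) (sym (toℕ-inject₁ i)) (proj₂ (wedge (toℕ i) (<⇒≤ (toℕ<n i))))
    ; close = subst₂ (λ s s′ → adj (x w s) (y w (a + s′))) (sym (+-identityʳ a)) (sym (toℕ-fromℕ m)) close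
    }
    where
    wedge : ∀ t → t ≤ m → Wedge adj (x w (a + t)) (y w (a + t)) (x w (suc (a + t)))
    wedge t t≤m = step w (a + t) (≤-trans (+-monoʳ-≤ a t≤m) a+m≤n)

  toCycle : (w : ClosedWalk (Wedge adj) n) → InjectiveBelow (x w) (suc n) → InjectiveBelow (y w) (suc n) →
            Cycle adj n
  toCycle {n} w injˣ injʸ =
    segmentCycle w 0 ≤-refl injˣ injʸ (subst (λ u → adj u (y w n)) (closed w) (proj₂ (step w n ≤-refl)))

  forgetProper : ClosedWalk (ProperWedge adj) n → ClosedWalk (Wedge adj) n
  forgetProper w = mapWalk (λ u → u) (λ v → v) w λ t t≤n → proj₁ (step w t t≤n)

  -- The first repetition x i = x (suc (i + gap)) closes a cycle; gap ≠ 0 as the walk never returns immediately.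
  properWalk⇒cycle : (w : ClosedWalk (ProperWedge adj) n) → InjectiveBelow (y w) (suc n) →
                     ¬ ¬ (∃[ m ] 1 ≤ m × m ≤ n × Cycle adj m)
  properWalk⇒cycle {n} w injʸ k = injective-or-firstRepeat (x w) (suc (suc n)) λ where
      (inj₁ injˣ) → contradiction (injˣ (s≤s ≤-refl) (s≤s z≤n) (closed w)) λ ()
      (inj₂ r)    → shortcut r
    where
    shortcut : FirstRepeat (x w) (suc (suc n)) → ⊥
    shortcut record { i = i ; gap = zero ; bound = bound ; repeat = repeat } =
      proj₂ (step w i (≤-trans (m≤m+n i 0) (≤-pred (≤-pred bound))))
            (trans repeat (cong (x w ∘ suc) (+-identityʳ i)))
    shortcut record { i = i ; gap = suc gap ; bound = bound ; repeat = repeat ; injectiveBefore = injˣ } =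
      k (suc gap , s≤s z≤n , ≤-trans (m≤n+m (suc gap) i) i+gap≤n , cycle)
      where
      i+gap≤n : i + suc gap ≤ n
      i+gap≤n = ≤-pred (≤-pred bound)
      cycle : Cycle adj (suc gap)
      cycle = segmentCycle (forgetProper w) i i+gap≤n
        (InjectiveBelow-shift i (≤-reflexive (+-suc i (suc gap))) injˣ)
        (InjectiveBelow-shift i (≤-trans (≤-reflexive (+-suc i (suc gap))) (≤-pred bound)) injʸ)
        (subst (λ u → adj u (y w (i + suc gap))) (sym repeat) (proj₂ (proj₁ (step w (i + suc gap) i+gap≤n))))

module _ {adj : X → Y → Set} {g : ℕ} (girth : GirthAtLeast2 adj g) where

  -- The first repetition y i = y j closes the cycle x (suc i), …, x j, which is too short unless j = suc i;
  -- such stutters are spliced out.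
  shortWalk⇒constantʸ : ∀ n → suc n < g → (w : ClosedWalk (Wedge adj) n) → InjectiveBelow (x w) (suc n) →
                   ¬ ¬ (∃[ c ] ∀ t → t ≤ n → y w t ≡ c)
  shortWalk⇒constantʸ zero _ w _ k = k (y w 0 , λ { zero _ → refl })
  shortWalk⇒constantʸ (suc n) 2+n<g w injˣ k = injective-or-firstRepeat (y w) (suc (suc n)) λ where
      (inj₁ injʸ) → girth (suc n) (s≤s z≤n) 2+n<g (toCycle w injˣ injʸ)
      (inj₂ r)    → contract r
    where
    contract : FirstRepeat (y w) (suc (suc n)) → ⊥
    contract record { i = i ; gap = zero ; bound = bound ; repeat = repeat } =
      shortWalk⇒constantʸ n (<-trans (n<1+n _) 2+n<g) (splice w i≤n junction) (InjectiveBelow-skip (suc i) injˣ)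
        λ (c , const) → k (c , skip-cover i≤n yᵢ≡yᵢ₊₁ const)
      where
      i≤n : i ≤ n
      i≤n = ≤-trans (m≤m+n i 0) (≤-pred (≤-pred bound))
      yᵢ≡yᵢ₊₁ : y w i ≡ y w (suc i)
      yᵢ≡yᵢ₊₁ = trans repeat (cong (y w ∘ suc) (+-identityʳ i))
      junction : Wedge adj (x w i) (y w (suc i)) (x w (suc (suc i)))
      junction = subst (adj (x w i)) yᵢ≡yᵢ₊₁ (proj₁ (step w i (m≤n⇒m≤1+n i≤n))) ,
                 proj₂ (step w (suc i) (s≤s i≤n))
    contract record { i = i ; gap = suc gap ; bound = bound ; repeat = repeat ; injectiveBefore = injʸ } =
      girth (suc gap) (s≤s z≤n) 2+gap<g cycle
      where
      j≤1+n : suc (i + suc gap) ≤ suc n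
      j≤1+n = ≤-pred bound
      2+gap<g : suc (suc gap) < g
      2+gap<g = ≤-<-trans (≤-trans (s≤s (m≤n+m (suc gap) i)) j≤1+n) (<-trans (n<1+n _) 2+n<g)
      segmentʸ : InjectiveBelow (λ t → y w (suc i + t)) (suc (suc gap))
      segmentʸ t<2+gap t′<2+gap eq with m<1+n⇒m<n∨m≡n t<2+gap | m<1+n⇒m<n∨m≡n t′<2+gap
      ... | inj₁ t<1+gap | inj₁ t′<1+gap =
        +-cancelˡ-≡ (suc i) _ _ (injʸ (s≤s (+-monoʳ-< i t<1+gap)) (s≤s (+-monoʳ-< i t′<1+gap)) eq)
      ... | inj₂ refl    | inj₂ refl     = refl
      ... | inj₂ refl    | inj₁ t′<1+gap =
        contradiction (injʸ (s≤s (m≤m+n i _)) (s≤s (+-monoʳ-< i t′<1+gap)) (trans repeat eq)) (m≢1+m+n i)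
      ... | inj₁ t<1+gap | inj₂ refl     =
        contradiction (injʸ (s≤s (m≤m+n i _)) (s≤s (+-monoʳ-< i t<1+gap)) (trans repeat (sym eq))) (m≢1+m+n i)
      cycle : Cycle adj (suc gap)
      cycle = segmentCycle w (suc i) j≤1+n
        (InjectiveBelow-shift (suc i) (≤-trans (≤-reflexive (cong suc (+-suc i (suc gap)))) bound) injˣ)
        segmentʸ
        (subst (adj (x w (suc i))) repeat (proj₂ (step w i i≤1+n)))
        where
        i≤1+n : i ≤ suc n
        i≤1+n = ≤-trans (m≤m+n i _) (m≤n⇒m≤1+n (≤-pred j≤1+n))

module _ {A B : Set} (E : A → B → Set) {k : ℕ} (H : A → Fin k → Bool) where

  Product : A → B × Fin k → Set
  Product u p = E u (proj₁ p) × HAdj H u (proj₂ p)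

  IsCopy : TensorR A B k → Set
  IsCopy (inj₁ _) = ⊥
  IsCopy (inj₂ _) = ⊤

  -- A step of a cycle of G ⊗_H k with the layers of its two left ends forgotten.
  TensorStep : A → TensorR A B k → A → Set
  TensorStep u (inj₁ p) u′ = ProperWedge Product u p u′
  TensorStep u (inj₂ a) u′ = a ≡ u × a ≡ u′

  vertex : TensorL A k H → A
  vertex = proj₁ ∘ proj₁

  TensorL-≡ : ∀ {u u′ i i′} {h : HAdj H u i} {h′ : HAdj H u′ i′} → u ≡ u′ → i ≡ i′ →
              _≡_ {A = TensorL A k H} ((u , i) , h) ((u′ , i′) , h′)
  TensorL-≡ refl refl = cong ((_ , _) ,_) (Decidable⇒UIP.≡-irrelevant Bool._≟_ _ _)

  tensorStep : ∀ {p q} r → Wedge (TensorAdj E k H) p r q → p ≢ q → TensorStep (vertex p) r (vertex q)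
  tensorStep {(u , i) , Hui} {(u′ , i′) , Hu′i′} (inj₁ (v , j)) ((i≡j , Euv) , (i′≡j , Eu′v)) p≢q =
    ((Euv , subst (HAdj H u) i≡j Hui) , (Eu′v , subst (HAdj H u′) i′≡j Hu′i′)) ,
    λ u≡u′ → p≢q (TensorL-≡ u≡u′ (trans i≡j (sym i′≡j)))
  tensorStep (inj₂ a) (a≡u , a≡u′) _ = a≡u , a≡u′

  tensorWalk : Cycle (TensorAdj E k H) (suc n) → ClosedWalk TensorStep (suc n)
  tensorWalk c = mapWalk vertex (λ r → r) w λ t t≤1+n →
    tensorStep (y w t) (step w t t≤1+n) (adjacent-distinct w (cycleWalk-injectiveˣ c) t t≤1+n)
    where w = cycleWalk c

  -- The junk value p₀ is never used: copies do not occur on the walk.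
  properWalk : (w : ClosedWalk TensorStep n) → ¬ (∃ λ t → t ≤ n × IsCopy (y w t)) →
               ClosedWalk (ProperWedge Product) n
  properWalk w noCopy = mapWalk (λ u → u) (fromInj₁ λ _ → p₀) w λ t t≤n →
    properStep (y w t) (λ copy → noCopy (t , t≤n , copy)) (step w t t≤n)
    where
    p₀ : B × Fin k
    p₀ with y w 0 in y₀≡
    ... | inj₁ p = p
    ... | inj₂ _ = ⊥-elim (noCopy (0 , z≤n , subst IsCopy (sym y₀≡) tt))
    properStep : ∀ {u u′} r → ¬ IsCopy r → TensorStep u r u′ →
                 ProperWedge Product u (fromInj₁ (λ _ → p₀) r) u′
    properStep (inj₁ _) _       s = s
    properStep (inj₂ _) notCopy _ = ⊥-elim (notCopy tt)

  properWalk-injectiveʸ : (w : ClosedWalk TensorStep n) (noCopy : ¬ (∃ λ t → t ≤ n × IsCopy (y w t))) →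
                          InjectiveBelow (y w) (suc n) → InjectiveBelow (y (properWalk w noCopy)) (suc n)
  properWalk-injectiveʸ w noCopy inj {i} {j} i<1+n j<1+n eq =
    inj i<1+n j<1+n (inj₁-cancel (y w i) (y w j) (notCopy i<1+n) (notCopy j<1+n) eq)
    where
    notCopy : ∀ {t} → t < suc _ → ¬ IsCopy (y w t)
    notCopy {t} t<1+n copy = noCopy (t , ≤-pred t<1+n , copy)
    inj₁-cancel : ∀ {d} r r′ → ¬ IsCopy r → ¬ IsCopy r′ →
                  fromInj₁ d r ≡ fromInj₁ d r′ → r ≡ r′
    inj₁-cancel (inj₁ _) (inj₁ _) _ _ eq = cong inj₁ eq
    inj₁-cancel (inj₂ _) _ notCopy _ _ = ⊥-elim (notCopy tt)
    inj₁-cancel (inj₁ _) (inj₂ _) _ notCopy _ = ⊥-elim (notCopy tt)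

  copy⇒loop : ∀ {u u′} r → IsCopy r → TensorStep u r u′ → u′ ≡ u
  copy⇒loop (inj₂ a) _ (a≡u , a≡u′) = trans (sym a≡u′) a≡u

  loop⇒copy : ∀ {u u′} r → TensorStep u r u′ → u ≡ u′ → r ≡ inj₂ u
  loop⇒copy (inj₁ _) (_ , u≢u′) u≡u′ = contradiction u≡u′ u≢u′
  loop⇒copy (inj₂ _) (a≡u , _)  _    = cong inj₂ a≡u

  -- Both steps would pass through the copy of x 0.
  twoStepWalk-distinctˣ : (w : ClosedWalk TensorStep 1) → InjectiveBelow (y w) 2 → x w 0 ≢ x w 1
  twoStepWalk-distinctˣ w inj x₀≡x₁ = contradiction (inj (s≤s z≤n) (s≤s (s≤s z≤n)) y₀≡y₁) λ ()
    where
    y₀≡y₁ : y w 0 ≡ y w 1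
    y₀≡y₁ = trans (loop⇒copy (y w 0) (step w 0 z≤n) x₀≡x₁)
              (trans (cong inj₂ x₀≡x₁) (sym (loop⇒copy (y w 1) (step w 1 ≤-refl) x₁≡x₂)))
      where
      x₁≡x₂ : x w 1 ≡ x w 2
      x₁≡x₂ = trans (sym x₀≡x₁) (sym (closed w))

module _ {A B : Set} {E : A → B → Set} {g k : ℕ} {H : A → Fin k → Bool} (girth : GirthAtLeast2 E g)
         (noCommonNeighbour : ∀ m → 1 ≤ m → suc m < g → (c : Cycle (HAdj H) m) →
                              ¬ CommonNeighbour E (Cycle.u c)) where

  noShortProductCycle : ∀ m → 1 ≤ m → suc m < g → ¬ Cycle (Product E H) m
  noShortProductCycle m 1≤m 1+m<g c =
    shortWalk⇒constantʸ girth m 1+m<g walkᴱ (cycleWalk-injectiveˣ c) λ (b , const) →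
      noCommonNeighbour m 1≤m 1+m<g (cycleᴴ b const) (b , neighbour b const)
    where
    w : ClosedWalk (Wedge (Product E H)) m
    w = cycleWalk c
    walkᴱ : ClosedWalk (Wedge E) m
    walkᴱ = mapWalk (λ u → u) proj₁ w λ t t≤m → map proj₁ proj₁ (step w t t≤m)
    walkᴴ : ClosedWalk (Wedge (HAdj H)) m
    walkᴴ = mapWalk (λ u → u) proj₂ w λ t t≤m → map proj₂ proj₂ (step w t t≤m)
    cycleᴴ : ∀ b → (∀ t → t ≤ m → proj₁ (y w t) ≡ b) → Cycle (HAdj H) m
    cycleᴴ b const = toCycle walkᴴ (cycleWalk-injectiveˣ c) λ t<1+m t′<1+m eq →
      cycleWalk-injectiveʸ c t<1+m t′<1+m
        (×-≡,≡→≡ (trans (const _ (≤-pred t<1+m)) (sym (const _ (≤-pred t′<1+m))) , eq))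
    neighbour : ∀ b const → ∀ i → E (Cycle.u (cycleᴴ b const) i) b
    neighbour b const i =
      subst (E _) (const (toℕ i) (toℕ≤pred[n] i)) (proj₁ (proj₁ (step w (toℕ i) (toℕ≤pred[n] i))))

  noShortProperWalk : ∀ n → suc n < g → (w : ClosedWalk (ProperWedge (Product E H)) n) →
                      InjectiveBelow (y w) (suc n) → ⊥
  noShortProperWalk n 1+n<g w injʸ = properWalk⇒cycle w injʸ λ (m , 1≤m , m≤n , c) →
    noShortProductCycle m 1≤m (≤-<-trans (s≤s m≤n) 1+n<g) c

  noShortTensorWalk : ∀ n → suc (suc n) < g → (w : ClosedWalk (TensorStep E H) (suc n)) →
                      InjectiveBelow (y w) (suc (suc n)) → ⊥
  noShortTensorWalk-stutter : ∀ n → suc (suc n) < g → (w : ClosedWalk (TensorStep E H) (suc n)) →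
               InjectiveBelow (y w) (suc (suc n)) → ∀ t → t ≤ suc n → x w (suc t) ≡ x w t → ⊥

  noShortTensorWalk n 2+n<g w injʸ = ¬¬-excluded-middle {A = ∃ λ t → t ≤ suc n × IsCopy E H (y w t)} λ where
    (yes (t , t≤1+n , copy)) →
      noShortTensorWalk-stutter n 2+n<g w injʸ t t≤1+n (copy⇒loop E H (y w t) copy (step w t t≤1+n))
    (no noCopy) →
      noShortProperWalk (suc n) 2+n<g (properWalk E H w noCopy) (properWalk-injectiveʸ E H w noCopy injʸ)

  noShortTensorWalk-stutter zero    _ w injʸ zero          _ stutter = twoStepWalk-distinctˣ E H w injʸ (sym stutter)
  noShortTensorWalk-stutter zero    _ w injʸ (suc zero)    _ stutter =
    twoStepWalk-distinctˣ E H w injʸ (trans (sym (closed w)) stutter)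
  noShortTensorWalk-stutter zero    _ _ _    (suc (suc _)) (s≤s ()) _
  noShortTensorWalk-stutter (suc n) 3+n<g w injʸ t t≤2+n stutter with m≤n⇒m<n∨m≡n t≤2+n
  ... | inj₁ t<2+n =
    noShortTensorWalk n (<-trans (n<1+n _) 3+n<g) (splice w (≤-pred t<2+n) junction) (InjectiveBelow-skip t injʸ)
    where
    junction : TensorStep E H (x w t) (y w (suc t)) (x w (suc (suc t)))
    junction = subst (λ u → TensorStep E H u (y w (suc t)) (x w (suc (suc t)))) stutter (step w (suc t) t<2+n)
  ... | inj₂ refl  = noShortTensorWalk n (<-trans (n<1+n _) 3+n<g) (dropLast w (trans (sym stutter) (closed w)))
                       λ t<1+n t′<1+n → injʸ (m<n⇒m<1+n t<1+n) (m<n⇒m<1+n t′<1+n)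

lemma5p5 : (A B : Set) (E : A → B → Set) (g k : ℕ) → 1 ≤ k →
    (H : A → Fin k → Bool) →
    GirthAtLeast2 E g →
    (∀ m → 1 ≤ m → suc m < g → (c : Cycle (HAdj H) m) →
      ¬ CommonNeighbour E (Cycle.u c)) →
    GirthAtLeast2 (TensorAdj E k H) g
lemma5p5 A B E g k _ H girth noCommonNeighbour zero    ()  _     _
lemma5p5 A B E g k _ H girth noCommonNeighbour (suc n) _   2+n<g c =
  noShortTensorWalk girth noCommonNeighbour n 2+n<g (tensorWalk E H c) (cycleWalk-injectiveʸ c)
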